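{- Let $\tau=(w,x)$ be a pair, $p\in X^c_\tau$, $q=p^\uparrow_\tau$ and $t\in R_\tau$. Suppose that $q\in X^c_{(xt,x)}$ but $p\in X_{(xt,x)}$. Assume that $P^\uparrow_\tau(p)$ is not satisfied but $Q^\downarrow_\tau(q)$ is satisfied. Then $P^\downarrow_\tau(q)$ is satisfied.
   Context: $S_n$ is the symmetric group on $\{1,\dots,n\}$ with Bruhat order $\le$; $\Box=\{0,\dots,n\}^2$. For $w\in S_n$, $\mathrm{rk}_w(i,j)=\#\{u\le i:w(u)\le j\}$ on $\Box$, and $D_w((i,j),(i',j'))=\mathrm{rk}_w(i,j)+\mathrm{rk}_w(i',j')-\mathrm{rk}_w(i,j')-\mathrm{rk}_w(i',j)$. A pair is $\sigma=(u,v)$ with $v\le u$; $\mathrm{rk}_\sigma=\mathrm{rk}_v-\mathrm{rk}_u$, $X_\sigma=\{p\in\Box:\mathrm{rk}_\sigma(p)=0\}$, $X^c_\sigma=\Box\setminus X_\sigma$. For $\tau=(w,x)$, $R_\tau=\{t\text{ transposition}:x<xt\le w\}$; for $t\in R_\tau$, $(xt,x)$ is a pair. For $\tau$ and $p=(i,j)\in\Box$ with $1\le j\le n-1$: $j^+=\min\{k>j:(i,k)\in X_\tau\}$, $i^+=\max\{l\ge i:(l,j^+)\in X_\tau,\ D_w(p,(l,j^+))=0\}$, $p^\downarrow_\tau=(i^+,j)$; $j^-=\max\{k<j:(i,k)\in X_\tau\}$, $i^-=\min\{l\le i:(l,j^-)\in X_\tau,\ D_w(p,(l,j^-))=0\}$,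 $p^\uparrow_\tau=(i^-,j)$. $P^\downarrow_\tau(p)$ means $\mathrm{rk}_\tau(p^\downarrow_\tau)<\mathrm{rk}_\tau(p)$, $P^\uparrow_\tau(p)$ means $\mathrm{rk}_\tau(p^\uparrow_\tau)<\mathrm{rk}_\tau(p)$, and $Q^\downarrow_\tau(p)$ means $P^\downarrow_\tau(p)\vee P^\uparrow_\tau(p^\downarrow_\tau)$. -}

module Defs where

open import Data.Nat using (ℕ; zero; suc; _<ᵇ_; _∸_; pred)
open import Data.Integer using (ℤ; +_; _-_; _+_; _<_)
import Data.Integer as ℤ
open import Data.Bool using (Bool; true; false; if_then_else_; _∧_)
open import Data.Fin using (Fin; toℕ)
open import Data.Fin.Permutation using (Permutation′; _⟨$⟩ʳ_; _∘ₚ_; transpose)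
open import Data.List using (List; length; filterᵇ; allFin)
open import Data.Sum using (_⊎_)
open import Data.Product using (_×_; Σ; ∃; ∃-syntax; _,_)
open import Relation.Nullary using (¬_)
open import Relation.Nullary.Decidable using (⌊_⌋)
open import Relation.Binary.PropositionalEquality using (_≡_)

-- Permutations of {1,…,n} are represented by Fin n (0-based: the element
-- u ∈ {1,…,n} is the Fin n element with toℕ = u - 1).

-- rk_w(i,j) = #{u ≤ i : w(u) ≤ j}, for any i j : ℕ (the box is i,j ≤ n).
rk : ∀ {n} → Permutation′ n → ℕ → ℕ → ℕ
rk {n} w i j =
  length (filterᵇ (λ u → (toℕ u <ᵇ i) ∧ (toℕ (w ⟨$⟩ʳ u) <ᵇ j)) (allFin n))

D : ∀ {n} → Permutation′ n → ℕ × ℕ → ℕ × ℕ → ℤ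
D w (i , j) (i' , j') =
  ((+ rk w i j) + (+ rk w i' j')) - ((+ rk w i j') + (+ rk w i' j))

-- Bruhat order, via the rank (tableau) criterion: v ≤ u iff rk_v ≥ rk_u on the box.
_≤B_ : ∀ {n} → Permutation′ n → Permutation′ n → Set
_≤B_ {n} v u = ∀ i j → i Data.Nat.≤ n → j Data.Nat.≤ n → rk u i j Data.Nat.≤ rk v i j

_<B_ : ∀ {n} → Permutation′ n → Permutation′ n → Set
v <B u = (v ≤B u) × ¬ (∀ k → v ⟨$⟩ʳ k ≡ u ⟨$⟩ʳ k)

-- A pair σ = (u , v) with v ≤ u; we pass u and v separately.
-- rk_σ = rk_v - rk_u
rkσ : ∀ {n} → (u v : Permutation′ n) → ℕ → ℕ → ℤ
rkσ u v i j = (+ rk v i j) - (+ rk u i j)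

inXᵇ : ∀ {n} → (u v : Permutation′ n) → ℕ → ℕ → Bool
inXᵇ u v i j = ⌊ rkσ u v i j ℤ.≟ + 0 ⌋

InX : ∀ {n} → (u v : Permutation′ n) → ℕ × ℕ → Set
InX u v (i , j) = rkσ u v i j ≡ + 0

-- right multiplication x t, i.e. (x t)(k) = x (t k), t = transposition of a,b
_·t[_,_] : ∀ {n} → Permutation′ n → Fin n → Fin n → Permutation′ n
x ·t[ a , b ] = transpose a b ∘ₚ x

InR : ∀ {n} → (w x : Permutation′ n) → Fin n → Fin n → Set
InR w x a b = ¬ (a ≡ b) × (x <B (x ·t[ a , b ])) × ((x ·t[ a , b ]) ≤B w)

-- Finite searches.
-- minFrom P a m : least k ∈ [a, a+m] with P k (fallback a+m)
minFrom : (ℕ → Bool) → ℕ → ℕ → ℕ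
minFrom P a zero = a
minFrom P a (suc m) = if P a then a else minFrom P (suc a) m

-- maxDown P b m : greatest k ∈ [b∸m, b] with P k (fallback b∸m)
maxDown : (ℕ → Bool) → ℕ → ℕ → ℕ
maxDown P b zero = b
maxDown P b (suc m) = if P b then b else maxDown P (pred b) m

minIn : (ℕ → Bool) → ℕ → ℕ → ℕ
minIn P a b = minFrom P a (b ∸ a)

maxIn : (ℕ → Bool) → ℕ → ℕ → ℕ
maxIn P a b = maxDown P b (b ∸ a)

D0ᵇ : ∀ {n} → Permutation′ n → ℕ × ℕ → ℕ × ℕ → Bool
D0ᵇ w p p' = ⌊ D w p p' ℤ.≟ + 0 ⌋

-- p^↓_τ and p^↑_τ for τ = (w , x), p = (i , j) with 1 ≤ j ≤ n-1.
-- (The sets minimised/maximised are nonempty: (i,n),(i,0) ∈ X_τ and l = i qualifies.)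
jPlus : ∀ {n} → (w x : Permutation′ n) → ℕ × ℕ → ℕ
jPlus {n} w x (i , j) = minIn (λ k → inXᵇ w x i k) (suc j) n

down : ∀ {n} → (w x : Permutation′ n) → ℕ × ℕ → ℕ × ℕ
down {n} w x (i , j) =
  let j⁺ = jPlus w x (i , j)
  in maxIn (λ l → inXᵇ w x l j⁺ ∧ D0ᵇ w (i , j) (l , j⁺)) i n , j

jMinus : ∀ {n} → (w x : Permutation′ n) → ℕ × ℕ → ℕ
jMinus w x (i , j) = maxIn (λ k → inXᵇ w x i k) 0 (pred j)

up : ∀ {n} → (w x : Permutation′ n) → ℕ × ℕ → ℕ × ℕ
up w x (i , j) =
  let j⁻ = jMinus w x (i , j)
  in minIn (λ l → inXᵇ w x l j⁻ ∧ D0ᵇ w (i , j) (l , j⁻)) 0 i , j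

rkτ : ∀ {n} → (w x : Permutation′ n) → ℕ × ℕ → ℤ
rkτ w x (i , j) = rkσ w x i j

P↓ : ∀ {n} → (w x : Permutation′ n) → ℕ × ℕ → Set
P↓ w x p = rkτ w x (down w x p) < rkτ w x p

P↑ : ∀ {n} → (w x : Permutation′ n) → ℕ × ℕ → Set
P↑ w x p = rkτ w x (up w x p) < rkτ w x p

Q↓ : ∀ {n} → (w x : Permutation′ n) → ℕ × ℕ → Set
Q↓ w x p = P↓ w x p ⊎ P↑ w x (down w x p)

-- Lemma 4.12: for a pair τ = (w , x), a point p = (i , j) and t ∈ R_τ with
-- q = p↑ ∉ X_(xt,x), p ∈ X_(xt,x), ¬ P↑(p) and Q↓(q), the property P↓(q) holds.
--
-- Write T = rk_x - rk_w (the rank of τ, rkσ w x) and □ f for the mixed second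
-- difference of a function f over a box.  The rank function of any finite point
-- set, hence of any permutation, has nonnegative boxes, so a flat (zero) box
-- stays flat when cut into pieces; D_w is exactly the box of rk_w.  Let q↓ = (M , j).
--   * If i ≤ M, one linear identity writes T(q) - T(q↓) as the positive rank
--     of (xt , x) at q plus nonnegative box and Bruhat terms (lower-row-drops).
--   * If M ≤ i and P↓(q) fails, then ¬ P↑(p) makes the box spanned by q and p
--     flat for w and x.  Cutting it along row M shows that (M , j)↑ lies in the
--     column of p↑ (up-column-stable) and not above q (up-row-stable), hence
--     T does not drop from q↓ to (M , j)↑: P↑(q↓) fails (no-up-after-down),
--     and Q↓(q) leaves P↓(q).
module Submission where

open import Defs
open import Data.Nat using (ℕ; _≤_; _<_)
open import Data.Fin using (Fin)
open import Data.Fin.Permutation using (Permutation′)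
open import Data.Product using (_×_; _,_)
open import Relation.Nullary using (¬_)

import Data.Nat as ℕ
open import Data.Nat using (zero; suc; pred; z≤n; _<ᵇ_; _∸_)
import Data.Nat.Properties as ℕP
open import Data.Nat.Tactic.RingSolver as ℕSolver using ()
open import Data.Integer as ℤ using (ℤ; +_; 0ℤ; _+_; _-_; +≤+)
  renaming (_≤_ to _≤ℤ_; _<_ to _<ℤ_)
import Data.Integer.Properties as ℤP
open import Data.Integer.Tactic.RingSolver using (solve-∀)
open import Data.Bool using (Bool; true; false; T; _∧_)
open import Data.Bool.Properties using (T-∧)
open import Data.Fin using (toℕ)
open import Data.Fin.Properties using (toℕ<n)
open import Data.Fin.Permutation using (_⟨$⟩ʳ_)
open import Data.List using (List; []; _∷_; length; filterᵇ; allFin)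
open import Data.List.Properties using (filter-none; filter-≐)
open import Data.List.Relation.Unary.All using (universal)
open import Data.Product using (proj₁; proj₂)
open import Data.Sum using (_⊎_; inj₁; inj₂)
open import Data.Unit using (tt)
open import Function using (_∘_)
open import Function.Bundles using (Equivalence)
open import Relation.Nullary using (contradiction)
open import Relation.Nullary.Decidable using (toWitness; fromWitness; decidable-stable)
open import Relation.Binary.PropositionalEquality
  using (_≡_; refl; sym; trans; cong; cong₂; subst; subst₂; module ≡-Reasoning)

-- Boxes of integer-valued functions on the grid

-- The mixed second difference of f over the box [i₁,i₂] × [j₁,j₂].
-- By definition D w (i₁ , j₁) (i₂ , j₂) is □ (ρ w) i₁ i₂ j₁ j₂.
□ : (ℕ → ℕ → ℤ) → ℕ → ℕ → ℕ → ℕ → ℤ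
□ f i₁ i₂ j₁ j₂ = (f i₁ j₁ + f i₂ j₂) - (f i₁ j₂ + f i₂ j₁)

module _ (f : ℕ → ℕ → ℤ) where

  □-degenerate : ∀ i j₁ j₂ → □ f i i j₁ j₂ ≡ 0ℤ
  □-degenerate i j₁ j₂ = identity (f i j₁) (f i j₂)
    where
    identity : ∀ a b → (a + b) - (b + a) ≡ 0ℤ
    identity = solve-∀

  □-flip : ∀ i₁ i₂ j₁ j₂ → □ f i₂ i₁ j₂ j₁ ≡ □ f i₁ i₂ j₁ j₂
  □-flip i₁ i₂ j₁ j₂ =
    cong₂ _-_ (ℤP.+-comm (f i₂ j₂) (f i₁ j₁)) (ℤP.+-comm (f i₂ j₁) (f i₁ j₂))

  □-rows : ∀ a b c j₁ j₂ → □ f a c j₁ j₂ ≡ □ f a b j₁ j₂ + □ f b c j₁ j₂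
  □-rows a b c j₁ j₂ = identity (f a j₁) (f a j₂) (f b j₁) (f b j₂) (f c j₁) (f c j₂)
    where
    identity : ∀ a₁ a₂ b₁ b₂ c₁ c₂ →
      (a₁ + c₂) - (a₂ + c₁) ≡ ((a₁ + b₂) - (a₂ + b₁)) + ((b₁ + c₂) - (b₂ + c₁))
    identity = solve-∀

  □-cols : ∀ i₁ i₂ a b c → □ f i₁ i₂ a c ≡ □ f i₁ i₂ a b + □ f i₁ i₂ b c
  □-cols i₁ i₂ a b c = identity (f i₁ a) (f i₂ a) (f i₁ b) (f i₂ b) (f i₁ c) (f i₂ c)
    where
    identity : ∀ a₁ a₂ b₁ b₂ c₁ c₂ →
      (a₁ + c₂) - (c₁ + a₂) ≡ ((a₁ + b₂) - (b₁ + a₂)) + ((b₁ + c₂) - (c₁ + b₂))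
    identity = solve-∀

  □-left-zero : ∀ i₁ i₂ j₁ j₂ → f i₁ j₁ ≡ 0ℤ → f i₂ j₁ ≡ 0ℤ →
    □ f i₁ i₂ j₁ j₂ ≡ f i₂ j₂ - f i₁ j₂
  □-left-zero i₁ i₂ j₁ j₂ e₁ e₂ rewrite e₁ | e₂ = identity (f i₁ j₂) (f i₂ j₂)
    where
    identity : ∀ a b → (0ℤ + b) - (a + 0ℤ) ≡ b - a
    identity = solve-∀

  □-right-zero : ∀ i₁ i₂ j₁ j₂ → f i₁ j₂ ≡ 0ℤ → f i₂ j₂ ≡ 0ℤ →
    □ f i₁ i₂ j₁ j₂ ≡ f i₁ j₁ - f i₂ j₁
  □-right-zero i₁ i₂ j₁ j₂ e₁ e₂ rewrite e₁ | e₂ = identity (f i₁ j₁) (f i₂ j₁)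
    where
    identity : ∀ a b → (a + 0ℤ) - (0ℤ + b) ≡ a - b
    identity = solve-∀

  flat-□-corner : ∀ i₁ i₂ j₁ j₂ → □ f i₁ i₂ j₁ j₂ ≡ 0ℤ → f i₁ j₁ ≡ 0ℤ →
    f i₂ j₂ ≡ f i₁ j₂ → f i₂ j₁ ≡ 0ℤ
  flat-□-corner i₁ i₂ j₁ j₂ flat e₁ e₂ =
    trans (identity (f i₂ j₁) (f i₁ j₂)) (cong ℤ.-_ flat′)
    where
    identity : ∀ c b → c ≡ ℤ.- ((0ℤ + b) - (b + c))
    identity = solve-∀
    flat′ : (0ℤ + f i₁ j₂) - (f i₁ j₂ + f i₂ j₁) ≡ 0ℤ
    flat′ = subst (λ z → (0ℤ + z) - (f i₁ j₂ + f i₂ j₁) ≡ 0ℤ) e₂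
              (subst (λ z → (z + f i₂ j₂) - (f i₁ j₂ + f i₂ j₁) ≡ 0ℤ) e₁ flat)

□-sub : ∀ (g f : ℕ → ℕ → ℤ) i₁ i₂ j₁ j₂ →
  □ (λ i j → g i j - f i j) i₁ i₂ j₁ j₂ ≡ □ g i₁ i₂ j₁ j₂ - □ f i₁ i₂ j₁ j₂
□-sub g f i₁ i₂ j₁ j₂ =
  identity (g i₁ j₁) (g i₂ j₂) (g i₁ j₂) (g i₂ j₁) (f i₁ j₁) (f i₂ j₂) (f i₁ j₂) (f i₂ j₁)
  where
  identity : ∀ a b c d a′ b′ c′ d′ →
    ((a - a′) + (b - b′)) - ((c - c′) + (d - d′)) ≡ ((a + b) - (c + d)) - ((a′ + b′) - (c′ + d′))
  identity = solve-∀

nonneg-sum-zero : ∀ {a b} → 0ℤ ≤ℤ a → 0ℤ ≤ℤ b → a + b ≡ 0ℤ → (a ≡ 0ℤ) × (b ≡ 0ℤ)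
nonneg-sum-zero {+ k} {+ l} (+≤+ _) (+≤+ _) e =
  cong +_ (ℕP.m+n≡0⇒m≡0 k e′) , cong +_ (ℕP.m+n≡0⇒n≡0 k e′)
  where
  e′ : k ℕ.+ l ≡ 0
  e′ = cong ℤ.∣_∣ e

pos-diff⇒< : ∀ a b → 0ℤ <ℤ b - a → a <ℤ b
pos-diff⇒< a b 0<b-a = subst₂ _<ℤ_ (ℤP.+-identityʳ a) (identity a b) (ℤP.+-monoʳ-< a 0<b-a)
  where
  identity : ∀ a b → a + (b - a) ≡ b
  identity = solve-∀

-- Rank functions of finite point sets

count : {A : Set} → (A → Bool) → List A → ℕ
count p xs = length (filterᵇ p xs)

quadrant : {A : Set} → (A → ℕ) → (A → ℕ) → List A → ℕ → ℕ → ℕ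
quadrant r c xs i j = count (λ u → (r u <ᵇ i) ∧ (c u <ᵇ j)) xs

indicator : Bool → ℕ
indicator true = 1
indicator false = 0

count-∷ : ∀ {A : Set} (p : A → Bool) u xs → count p (u ∷ xs) ≡ indicator (p u) ℕ.+ count p xs
count-∷ p u xs with p u
... | true = refl
... | false = refl

count-mono₂ : ∀ {A : Set} (p₁ p₂ p₃ p₄ : A → Bool) →
  (∀ u → indicator (p₁ u) ℕ.+ indicator (p₂ u) ≤ indicator (p₃ u) ℕ.+ indicator (p₄ u)) →
  ∀ xs → count p₁ xs ℕ.+ count p₂ xs ≤ count p₃ xs ℕ.+ count p₄ xs
count-mono₂ p₁ p₂ p₃ p₄ pointwise [] = z≤n
count-mono₂ p₁ p₂ p₃ p₄ pointwise (u ∷ xs)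
  rewrite count-∷ p₁ u xs | count-∷ p₂ u xs | count-∷ p₃ u xs | count-∷ p₄ u xs =
  subst₂ _≤_ (shuffle (indicator (p₁ u)) (count p₁ xs) (indicator (p₂ u)) (count p₂ xs))
             (shuffle (indicator (p₃ u)) (count p₃ xs) (indicator (p₄ u)) (count p₄ xs))
    (ℕP.+-mono-≤ (pointwise u) (count-mono₂ p₁ p₂ p₃ p₄ pointwise xs))
  where
  shuffle : ∀ a b c d → (a ℕ.+ c) ℕ.+ (b ℕ.+ d) ≡ (a ℕ.+ b) ℕ.+ (c ℕ.+ d)
  shuffle = ℕSolver.solve-∀

<ᵇ-mono : ∀ u {i₁ i₂} → i₁ ≤ i₂ → T (u <ᵇ i₁) → T (u <ᵇ i₂)
<ᵇ-mono u {i₁} i₁≤i₂ = ℕP.<⇒<ᵇ ∘ (λ u<i₁ → ℕP.<-≤-trans u<i₁ i₁≤i₂) ∘ ℕP.<ᵇ⇒< u i₁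

indicator-box : ∀ {a₁ a₂ b₁ b₂} → (T a₁ → T a₂) → (T b₁ → T b₂) →
  indicator (a₁ ∧ b₂) ℕ.+ indicator (a₂ ∧ b₁) ≤ indicator (a₁ ∧ b₁) ℕ.+ indicator (a₂ ∧ b₂)
indicator-box {true} {true} {b₁} {b₂} _ _ = ℕP.≤-reflexive (ℕP.+-comm (indicator b₂) (indicator b₁))
indicator-box {true} {false} a₁⇒a₂ _ = contradiction tt a₁⇒a₂
indicator-box {false} {true} {true} {true} _ _ = ℕP.≤-refl
indicator-box {false} {true} {true} {false} _ b₁⇒b₂ = contradiction tt b₁⇒b₂
indicator-box {false} {true} {false} _ _ = z≤n
indicator-box {false} {false} _ _ = z≤n

quadrant-supermodular : ∀ {A : Set} (r c : A → ℕ) {i₁ i₂ j₁ j₂} → i₁ ≤ i₂ → j₁ ≤ j₂ → ∀ xs →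
  quadrant r c xs i₁ j₂ ℕ.+ quadrant r c xs i₂ j₁ ≤ quadrant r c xs i₁ j₁ ℕ.+ quadrant r c xs i₂ j₂
quadrant-supermodular r c {i₁} {i₂} {j₁} {j₂} i₁≤i₂ j₁≤j₂ =
  count-mono₂ (corner i₁ j₂) (corner i₂ j₁) (corner i₁ j₁) (corner i₂ j₂)
    (λ u → indicator-box (<ᵇ-mono (r u) i₁≤i₂) (<ᵇ-mono (c u) j₁≤j₂))
  where
  corner : ℕ → ℕ → _ → Bool
  corner i j u = (r u <ᵇ i) ∧ (c u <ᵇ j)

quadrant-col0 : ∀ {A : Set} (r c : A → ℕ) xs i → quadrant r c xs i 0 ≡ 0
quadrant-col0 r c xs i =
  cong length (filter-none _ (universal (λ u → ℕP.n≮0 ∘ ℕP.<ᵇ⇒< (c u) 0 ∘ proj₂ ∘ Equivalence.to T-∧) xs))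

quadrant-full : ∀ {A : Set} (r c : A → ℕ) xs i j → (∀ u → c u < j) →
  quadrant r c xs i j ≡ count (λ u → r u <ᵇ i) xs
quadrant-full r c xs i j c<j =
  cong length (filter-≐ _ _ (proj₁ ∘ Equivalence.to T-∧ ,
                             λ {u} r<i → Equivalence.from T-∧ (r<i , ℕP.<⇒<ᵇ (c<j u))) xs)

ρ : ∀ {n} → Permutation′ n → ℕ → ℕ → ℤ
ρ π i j = + rk π i j

□ρ-nonneg : ∀ {n} (π : Permutation′ n) {i₁ i₂ j₁ j₂} → i₁ ≤ i₂ → j₁ ≤ j₂ →
  0ℤ ≤ℤ □ (ρ π) i₁ i₂ j₁ j₂
□ρ-nonneg {n} π i₁≤i₂ j₁≤j₂ =
  ℤP.i≤j⇒0≤j-i (+≤+ (quadrant-supermodular toℕ (toℕ ∘ (π ⟨$⟩ʳ_)) i₁≤i₂ j₁≤j₂ (allFin n)))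

□ρ-split-rows : ∀ {n} (π : Permutation′ n) {i₁ k i₂ j₁ j₂} → i₁ ≤ k → k ≤ i₂ → j₁ ≤ j₂ →
  □ (ρ π) i₁ i₂ j₁ j₂ ≡ 0ℤ → (□ (ρ π) i₁ k j₁ j₂ ≡ 0ℤ) × (□ (ρ π) k i₂ j₁ j₂ ≡ 0ℤ)
□ρ-split-rows π {i₁} {k} {i₂} {j₁} {j₂} i₁≤k k≤i₂ j₁≤j₂ flat =
  nonneg-sum-zero (□ρ-nonneg π i₁≤k j₁≤j₂) (□ρ-nonneg π k≤i₂ j₁≤j₂)
    (trans (sym (□-rows (ρ π) i₁ k i₂ j₁ j₂)) flat)

□ρ-split-cols : ∀ {n} (π : Permutation′ n) {i₁ i₂ j₁ k j₂} → i₁ ≤ i₂ → j₁ ≤ k → k ≤ j₂ →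
  □ (ρ π) i₁ i₂ j₁ j₂ ≡ 0ℤ → (□ (ρ π) i₁ i₂ j₁ k ≡ 0ℤ) × (□ (ρ π) i₁ i₂ k j₂ ≡ 0ℤ)
□ρ-split-cols π {i₁} {i₂} {j₁} {k} {j₂} i₁≤i₂ j₁≤k k≤j₂ flat =
  nonneg-sum-zero (□ρ-nonneg π i₁≤i₂ j₁≤k) (□ρ-nonneg π i₁≤i₂ k≤j₂)
    (trans (sym (□-cols (ρ π) i₁ i₂ j₁ k j₂)) flat)

X-col0 : ∀ {n} (u v : Permutation′ n) i → InX u v (i , 0)
X-col0 {n} u v i =
  cong₂ (λ a b → + a - + b) (quadrant-col0 toℕ (toℕ ∘ (v ⟨$⟩ʳ_)) (allFin n) i)
                            (quadrant-col0 toℕ (toℕ ∘ (u ⟨$⟩ʳ_)) (allFin n) i)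

X-coln : ∀ {n} (u v : Permutation′ n) i → InX u v (i , n)
X-coln {n} u v i
  rewrite quadrant-full toℕ (toℕ ∘ (v ⟨$⟩ʳ_)) (allFin n) i n (toℕ<n ∘ (v ⟨$⟩ʳ_))
        | quadrant-full toℕ (toℕ ∘ (u ⟨$⟩ʳ_)) (allFin n) i n (toℕ<n ∘ (u ⟨$⟩ʳ_))
  = ℤP.+-inverseʳ (+ count (λ k → toℕ k <ᵇ i) (allFin n))

rkσ-nonneg : ∀ {n} (u v : Permutation′ n) {i j} → v ≤B u → i ≤ n → j ≤ n → 0ℤ ≤ℤ rkσ u v i j
rkσ-nonneg u v v≤u i≤n j≤n = ℤP.i≤j⇒0≤j-i (+≤+ (v≤u _ _ i≤n j≤n))

rkσ-pos : ∀ {n} (u v : Permutation′ n) {i j} → v ≤B u → i ≤ n → j ≤ n →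
  ¬ InX u v (i , j) → 0ℤ <ℤ rkσ u v i j
rkσ-pos u v v≤u i≤n j≤n ∉X = ℤP.≤∧≢⇒< (rkσ-nonneg u v v≤u i≤n j≤n) (∉X ∘ sym)

record Flat {n} (w x : Permutation′ n) (i₁ i₂ j₁ j₂ : ℕ) : Set where
  constructor flat
  field
    w-flat : □ (ρ w) i₁ i₂ j₁ j₂ ≡ 0ℤ
    x-flat : □ (ρ x) i₁ i₂ j₁ j₂ ≡ 0ℤ

flat-rows : ∀ {n} {w x : Permutation′ n} {i₁ k i₂ j₁ j₂} → i₁ ≤ k → k ≤ i₂ → j₁ ≤ j₂ →
  Flat w x i₁ i₂ j₁ j₂ → Flat w x i₁ k j₁ j₂ × Flat w x k i₂ j₁ j₂
flat-rows {w = w} {x} i₁≤k k≤i₂ j₁≤j₂ (flat flat-w flat-x) =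
  let (w₁ , w₂) = □ρ-split-rows w i₁≤k k≤i₂ j₁≤j₂ flat-w
      (x₁ , x₂) = □ρ-split-rows x i₁≤k k≤i₂ j₁≤j₂ flat-x
  in flat w₁ x₁ , flat w₂ x₂

flat-cols : ∀ {n} {w x : Permutation′ n} {i₁ i₂ j₁ k j₂} → i₁ ≤ i₂ → j₁ ≤ k → k ≤ j₂ →
  Flat w x i₁ i₂ j₁ j₂ → Flat w x i₁ i₂ j₁ k × Flat w x i₁ i₂ k j₂
flat-cols {w = w} {x} i₁≤i₂ j₁≤k k≤j₂ (flat flat-w flat-x) =
  let (w₁ , w₂) = □ρ-split-cols w i₁≤i₂ j₁≤k k≤j₂ flat-w
      (x₁ , x₂) = □ρ-split-cols x i₁≤i₂ j₁≤k k≤j₂ flat-x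
  in flat w₁ x₁ , flat w₂ x₂

□τ≡□x : ∀ {n} (w x : Permutation′ n) i₁ i₂ j₁ j₂ → □ (ρ w) i₁ i₂ j₁ j₂ ≡ 0ℤ →
  □ (rkσ w x) i₁ i₂ j₁ j₂ ≡ □ (ρ x) i₁ i₂ j₁ j₂
□τ≡□x w x i₁ i₂ j₁ j₂ flat-w =
  trans (□-sub (ρ x) (ρ w) i₁ i₂ j₁ j₂)
        (trans (cong (□ (ρ x) i₁ i₂ j₁ j₂ -_) flat-w) (ℤP.+-identityʳ _))

□τ-nonneg : ∀ {n} (w x : Permutation′ n) {i₁ i₂ j₁ j₂} → i₁ ≤ i₂ → j₁ ≤ j₂ →
  □ (ρ w) i₁ i₂ j₁ j₂ ≡ 0ℤ → 0ℤ ≤ℤ □ (rkσ w x) i₁ i₂ j₁ j₂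
□τ-nonneg w x {i₁} {i₂} {j₁} {j₂} i₁≤i₂ j₁≤j₂ flat-w =
  subst (0ℤ ≤ℤ_) (sym (□τ≡□x w x i₁ i₂ j₁ j₂ flat-w)) (□ρ-nonneg x i₁≤i₂ j₁≤j₂)

flat⇒□τ≡0 : ∀ {n} {w x : Permutation′ n} {i₁ i₂ j₁ j₂} → Flat w x i₁ i₂ j₁ j₂ →
  □ (rkσ w x) i₁ i₂ j₁ j₂ ≡ 0ℤ
flat⇒□τ≡0 {w = w} {x} {i₁} {i₂} {j₁} {j₂} (flat flat-w flat-x) =
  trans (□τ≡□x w x i₁ i₂ j₁ j₂ flat-w) flat-x

record Least (P : ℕ → Bool) (a k : ℕ) : Set where
  field
    lower   : a ≤ k
    holds   : T (P k)
    minimal : ∀ {l} → a ≤ l → l < k → ¬ T (P l)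

record Greatest (P : ℕ → Bool) (b k : ℕ) : Set where
  field
    upper   : k ≤ b
    holds   : T (P k)
    maximal : ∀ {l} → k < l → l ≤ b → ¬ T (P l)

apart : ∀ (P : ℕ → Bool) {c d} → T (P c) → P d ≡ false → ¬ c ≡ d
apart P Pc Pd≡false refl = subst T Pd≡false Pc

minFrom-least : ∀ P a m {c} → a ≤ c → c ≤ a ℕ.+ m → T (P c) → Least P a (minFrom P a m)
minFrom-least P a zero {c} a≤c c≤a+0 Pc = record
  { lower = ℕP.≤-refl
  ; holds = subst (T ∘ P) (ℕP.≤-antisym (subst (c ≤_) (ℕP.+-identityʳ a) c≤a+0) a≤c) Pc
  ; minimal = λ a≤l l<a → contradiction a≤l (ℕP.<⇒≱ l<a) }
minFrom-least P a (suc m) {c} a≤c c≤a+m Pc with P a in Pa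
... | true = record
  { lower = ℕP.≤-refl
  ; holds = subst T (sym Pa) tt
  ; minimal = λ a≤l l<a → contradiction a≤l (ℕP.<⇒≱ l<a) }
... | false = record
  { lower = ℕP.≤-trans (ℕP.n≤1+n a) (Least.lower rest)
  ; holds = Least.holds rest
  ; minimal = minimal }
  where
  rest : Least P (suc a) (minFrom P (suc a) m)
  rest = minFrom-least P (suc a) m (ℕP.≤∧≢⇒< a≤c (apart P Pc Pa ∘ sym))
           (subst (c ≤_) (ℕP.+-suc a m) c≤a+m) Pc
  minimal : ∀ {l} → a ≤ l → l < minFrom P (suc a) m → ¬ T (P l)
  minimal a≤l l<k with ℕP.m≤n⇒m<n∨m≡n a≤l
  ... | inj₁ a<l = Least.minimal rest a<l l<k
  ... | inj₂ refl = subst T Pa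

maxDown-greatest : ∀ P b m {c} → b ∸ m ≤ c → c ≤ b → T (P c) → Greatest P b (maxDown P b m)
maxDown-greatest P b zero c≥b c≤b Pc = record
  { upper = ℕP.≤-refl
  ; holds = subst (T ∘ P) (ℕP.≤-antisym c≤b c≥b) Pc
  ; maximal = λ b<l l≤b → contradiction l≤b (ℕP.<⇒≱ b<l) }
maxDown-greatest P b (suc m) {c} c≥ c≤b Pc with P b in Pb
... | true = record
  { upper = ℕP.≤-refl
  ; holds = subst T (sym Pb) tt
  ; maximal = λ b<l l≤b → contradiction l≤b (ℕP.<⇒≱ b<l) }
... | false = record
  { upper = ℕP.≤-trans (Greatest.upper rest) ℕP.pred[n]≤n
  ; holds = Greatest.holds rest
  ; maximal = maximal }
  where
  c<b : c < b
  c<b = ℕP.≤∧≢⇒< c≤b (apart P Pc Pb)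
  pred-∸ : ∀ b → pred b ∸ m ≡ b ∸ suc m
  pred-∸ zero = ℕP.0∸n≡0 m
  pred-∸ (suc b) = refl
  rest : Greatest P (pred b) (maxDown P (pred b) m)
  rest = maxDown-greatest P (pred b) m (subst (_≤ c) (sym (pred-∸ b)) c≥)
           (ℕP.<⇒≤pred c<b) Pc
  maximal : ∀ {l} → maxDown P (pred b) m < l → l ≤ b → ¬ T (P l)
  maximal k<l l≤b with ℕP.m≤n⇒m<n∨m≡n l≤b
  ... | inj₁ l<b = Greatest.maximal rest k<l (ℕP.<⇒≤pred l<b)
  ... | inj₂ refl = subst T Pb

minIn-least : ∀ P a b {c} → a ≤ c → c ≤ b → T (P c) → Least P a (minIn P a b)
minIn-least P a b a≤c c≤b =
  minFrom-least P a (b ∸ a) a≤c (subst (_ ≤_) (sym (ℕP.m+[n∸m]≡n (ℕP.≤-trans a≤c c≤b))) c≤b)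

maxIn-greatest : ∀ P a b {c} → a ≤ c → c ≤ b → T (P c) → Greatest P b (maxIn P a b)
maxIn-greatest P a b a≤c c≤b =
  maxDown-greatest P b (b ∸ a) (subst (_≤ _) (sym (ℕP.m∸[m∸n]≡n (ℕP.≤-trans a≤c c≤b))) a≤c) c≤b

least-below : ∀ {P a k c} → Least P a k → a ≤ c → T (P c) → k ≤ c
least-below s a≤c Pc = ℕP.≮⇒≥ (λ c<k → Least.minimal s a≤c c<k Pc)

greatest-above : ∀ {P b k c} → Greatest P b k → c ≤ b → T (P c) → c ≤ k
greatest-above s c≤b Pc = ℕP.≮⇒≥ (λ k<c → Greatest.maximal s k<c c≤b Pc)

module _ {n} (w x : Permutation′ n) where

  inXᵇ⇒InX : ∀ i k → T (inXᵇ w x i k) → InX w x (i , k)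
  inXᵇ⇒InX i k = toWitness {a? = rkσ w x i k ℤ.≟ + 0}

  InX⇒inXᵇ : ∀ i k → InX w x (i , k) → T (inXᵇ w x i k)
  InX⇒inXᵇ i k = fromWitness {a? = rkσ w x i k ℤ.≟ + 0}

  InX∧D0 : ℕ × ℕ → ℕ → ℕ → Bool
  InX∧D0 p k l = inXᵇ w x l k ∧ D0ᵇ w p (l , k)

  InX∧D0⇒ : ∀ p k l → T (InX∧D0 p k l) → InX w x (l , k) × (D w p (l , k) ≡ + 0)
  InX∧D0⇒ p k l h =
    let (h₁ , h₂) = Equivalence.to T-∧ h
    in inXᵇ⇒InX l k h₁ , toWitness {a? = D w p (l , k) ℤ.≟ + 0} h₂

  ⇒InX∧D0 : ∀ p k l → InX w x (l , k) → D w p (l , k) ≡ + 0 → T (InX∧D0 p k l)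
  ⇒InX∧D0 p k l X D0 =
    Equivalence.from T-∧ (InX⇒inXᵇ l k X , fromWitness {a? = D w p (l , k) ℤ.≟ + 0} D0)

-- For p = (i , j): J = j⁻ and m = i⁻, so that p↑ = (m , j).
record UpData {n} (w x : Permutation′ n) (i j J m : ℕ) : Set where
  field
    J≤j-1 : J ≤ pred j
    X-iJ  : InX w x (i , J)
    J-max : ∀ {k} → J < k → k ≤ pred j → ¬ InX w x (i , k)
    m≤i   : m ≤ i
    X-mJ  : InX w x (m , J)
    D-mJ  : D w (i , j) (m , J) ≡ + 0
    m-min : ∀ {l} → l < m → InX w x (l , J) → ¬ D w (i , j) (l , J) ≡ + 0

upData : ∀ {n} (w x : Permutation′ n) i j →
  UpData w x i j (jMinus w x (i , j)) (proj₁ (up w x (i , j)))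
upData w x i j = record
  { J≤j-1 = Greatest.upper column
  ; X-iJ  = X-iJ
  ; J-max = λ {k} J<k k≤j-1 → Greatest.maximal column J<k k≤j-1 ∘ InX⇒inXᵇ w x i k
  ; m≤i   = least-below {c = i} row z≤n (⇒InX∧D0 w x (i , j) J i X-iJ (□-degenerate (ρ w) i j J))
  ; X-mJ  = proj₁ (InX∧D0⇒ w x (i , j) J m (Least.holds row))
  ; D-mJ  = proj₂ (InX∧D0⇒ w x (i , j) J m (Least.holds row))
  ; m-min = λ {l} l<m X D0 → Least.minimal row z≤n l<m (⇒InX∧D0 w x (i , j) J l X D0) }
  where
  J m : ℕ
  J = jMinus w x (i , j)
  m = proj₁ (up w x (i , j))
  column : Greatest (inXᵇ w x i) (pred j) J
  column = maxIn-greatest _ 0 (pred j) z≤n z≤n (InX⇒inXᵇ w x i 0 (X-col0 w x i))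
  X-iJ : InX w x (i , J)
  X-iJ = inXᵇ⇒InX w x i J (Greatest.holds column)
  row : Least (InX∧D0 w x (i , j) J) 0 m
  row = minIn-least _ 0 i z≤n ℕP.≤-refl (⇒InX∧D0 w x (i , j) J i X-iJ (□-degenerate (ρ w) i j J))

-- For q = (m , j): K = j⁺ and M = i⁺, so that q↓ = (M , j).
record DownData {n} (w x : Permutation′ n) (m j K M : ℕ) : Set where
  field
    j<K  : j < K
    K≤n  : K ≤ n
    X-mK : InX w x (m , K)
    m≤M  : m ≤ M
    X-MK : InX w x (M , K)
    D-MK : D w (m , j) (M , K) ≡ + 0

downData : ∀ {n} (w x : Permutation′ n) m j → j < n → m ≤ n →
  DownData w x m j (jPlus w x (m , j)) (proj₁ (down w x (m , j)))
downData {n} w x m j j<n m≤n = record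
  { j<K  = Least.lower column
  ; K≤n  = least-below {c = n} column j<n (InX⇒inXᵇ w x m n (X-coln w x m))
  ; X-mK = X-mK
  ; m≤M  = greatest-above {c = m} row m≤n (⇒InX∧D0 w x (m , j) K m X-mK (□-degenerate (ρ w) m j K))
  ; X-MK = proj₁ (InX∧D0⇒ w x (m , j) K M (Greatest.holds row))
  ; D-MK = proj₂ (InX∧D0⇒ w x (m , j) K M (Greatest.holds row)) }
  where
  K M : ℕ
  K = jPlus w x (m , j)
  M = proj₁ (down w x (m , j))
  column : Least (inXᵇ w x m) (suc j) K
  column = minIn-least _ (suc j) n j<n ℕP.≤-refl (InX⇒inXᵇ w x m n (X-coln w x m))
  X-mK : InX w x (m , K)
  X-mK = inXᵇ⇒InX w x m K (Least.holds column)
  row : Greatest (InX∧D0 w x (m , j) K) n M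
  row = maxIn-greatest _ m n ℕP.≤-refl m≤n (⇒InX∧D0 w x (m , j) K m X-mK (□-degenerate (ρ w) m j K))

-- Case i ≤ M: the row of q↓ has strictly smaller rank

drop-identity : ∀ (xmj xij xiK xMj xMK wmj wmK wMj wMK tmj tmK tij tiK : ℤ) →
  (xmj - wmj) - (xMj - wMj) ≡
    ((xmj - tmj) + ((tmK - wmK) + (xiK - tiK) + ((tmj + tiK) - (tmK + tij)) + ((xij + xMK) - (xiK + xMj))))
    - (xij - tij) - ((wmj + wMK) - (wmK + wMj)) - (xMK - wMK)
drop-identity = solve-∀

drop-zeros : ∀ {S Z₁ Z₂ Z₃} → Z₁ ≡ 0ℤ → Z₂ ≡ 0ℤ → Z₃ ≡ 0ℤ → S - Z₁ - Z₂ - Z₃ ≡ S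
drop-zeros {S} refl refl refl = identity S
  where
  identity : ∀ S → S - 0ℤ - 0ℤ - 0ℤ ≡ S
  identity = solve-∀

-- With t such that x ≤ t ≤ w, q = (m , j) ∉ X_(t,x) and p = (i , j) ∈ X_(t,x):
-- T(q) - T(q↓) = rk_(t,x)(q) + [nonnegative terms] > 0 when i ≤ M.
lower-row-drops : ∀ {n} (w x t : Permutation′ n) {i j m K M} → x ≤B t → t ≤B w →
  DownData w x m j K M → m ≤ i → i ≤ M → i ≤ n → j ≤ n →
  ¬ InX t x (m , j) → InX t x (i , j) → rkσ w x M j <ℤ rkσ w x m j
lower-row-drops {n} w x t {i} {j} {m} {K} {M} x≤t t≤w d m≤i i≤M i≤n j≤n q∉Xt p∈Xt =
  pos-diff⇒< _ _ (subst (0ℤ <ℤ_) (sym decomposition) (ℤP.+-mono-<-≤ q-pos rest-nonneg))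
  where
  open DownData d
  m≤n : m ≤ n
  m≤n = ℕP.≤-trans m≤i i≤n
  j≤K : j ≤ K
  j≤K = ℕP.<⇒≤ j<K
  -- the positive term: q lies outside X_(xt,x)
  q-pos : 0ℤ <ℤ rkσ t x m j
  q-pos = rkσ-pos t x x≤t m≤n j≤n q∉Xt
  rest-nonneg : 0ℤ ≤ℤ rkσ w t m K + rkσ t x i K + □ (ρ t) m i j K + □ (ρ x) i M j K
  rest-nonneg =
    ℤP.+-mono-≤ (ℤP.+-mono-≤ (ℤP.+-mono-≤ (rkσ-nonneg w t t≤w m≤n K≤n) (rkσ-nonneg t x x≤t i≤n K≤n))
                             (□ρ-nonneg t m≤i j≤K))
                (□ρ-nonneg x i≤M j≤K)
  decomposition : rkσ w x m j - rkσ w x M j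
    ≡ rkσ t x m j + (rkσ w t m K + rkσ t x i K + □ (ρ t) m i j K + □ (ρ x) i M j K)
  decomposition =
    trans (drop-identity (ρ x m j) (ρ x i j) (ρ x i K) (ρ x M j) (ρ x M K) (ρ w m j) (ρ w m K)
             (ρ w M j) (ρ w M K) (ρ t m j) (ρ t m K) (ρ t i j) (ρ t i K))
          (drop-zeros p∈Xt D-MK X-MK)

-- Case M ≤ i: P↓(q) and P↑(q↓) cannot fail and hold respectively

down-row-mono : ∀ {n} {w x : Permutation′ n} {m j K M} → DownData w x m j K M →
  rkσ w x M j ≤ℤ rkσ w x m j
down-row-mono {w = w} {x} {m} {j} {K} {M} d =
  ℤP.0≤i-j⇒j≤i (subst (0ℤ ≤ℤ_) (□-right-zero (rkσ w x) m M j K X-mK X-MK)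
                  (□τ-nonneg w x m≤M (ℕP.<⇒≤ j<K) D-MK))
  where open DownData d

up-box-flat : ∀ {n} {w x : Permutation′ n} {i j J m} → UpData w x i j J m →
  ¬ (rkσ w x m j <ℤ rkσ w x i j) → Flat w x m i J j × (rkσ w x i j ≡ rkσ w x m j)
up-box-flat {w = w} {x} {i} {j} {J} {m} u ¬P↑ = flat flat-w flat-x , T-ij≡T-mj
  where
  open UpData u
  J≤j : J ≤ j
  J≤j = ℕP.≤-trans J≤j-1 (ℕP.pred[n]≤n {j})
  flat-w : □ (ρ w) m i J j ≡ 0ℤ
  flat-w = trans (sym (□-flip (ρ w) m i J j)) D-mJ
  □τ≡jump : □ (rkσ w x) m i J j ≡ rkσ w x i j - rkσ w x m j
  □τ≡jump = □-left-zero (rkσ w x) m i J j X-mJ X-iJ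
  T-ij≡T-mj : rkσ w x i j ≡ rkσ w x m j
  T-ij≡T-mj = ℤP.≤-antisym (ℤP.≮⇒≥ ¬P↑)
    (ℤP.0≤i-j⇒j≤i (subst (0ℤ ≤ℤ_) □τ≡jump (□τ-nonneg w x m≤i J≤j flat-w)))
  flat-x : □ (ρ x) m i J j ≡ 0ℤ
  flat-x = begin
    □ (ρ x) m i J j           ≡⟨ sym (□τ≡□x w x m i J j flat-w) ⟩
    □ (rkσ w x) m i J j       ≡⟨ □τ≡jump ⟩
    rkσ w x i j - rkσ w x m j ≡⟨ cong (_- rkσ w x m j) T-ij≡T-mj ⟩
    rkσ w x m j - rkσ w x m j ≡⟨ ℤP.+-inverseʳ (rkσ w x m j) ⟩
    0ℤ                        ∎
    where open ≡-Reasoning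

up-column-stable : ∀ {n} {w x : Permutation′ n} {i j J m M J′ m′} →
  UpData w x i j J m → UpData w x M j J′ m′ → M ≤ i → Flat w x M i J j →
  InX w x (M , J) → rkσ w x i j ≡ rkσ w x M j → J′ ≡ J
up-column-stable {w = w} {x} {i} {j} {J} {m} {M} {J′} u u′ M≤i flat-Mi X-MJ τ-ij≡τ-Mj =
  ℕP.≤-antisym (ℕP.≮⇒≥ (λ J<J′ → U.J-max J<J′ U′.J≤j-1 X-iJ′)) J≤J′
  where
  module U = UpData u
  module U′ = UpData u′
  J≤J′ : J ≤ J′
  J≤J′ = ℕP.≮⇒≥ (λ J′<J → U′.J-max J′<J U.J≤j-1 X-MJ)
  J′≤j : J′ ≤ j
  J′≤j = ℕP.≤-trans U′.J≤j-1 (ℕP.pred[n]≤n {j})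
  -- the row i also meets X_τ in column J′, so J′ ≤ J by maximality of J
  X-iJ′ : InX w x (i , J′)
  X-iJ′ = flat-□-corner (rkσ w x) M i J′ j
    (flat⇒□τ≡0 (proj₂ (flat-cols M≤i J≤J′ J′≤j flat-Mi))) U′.X-iJ τ-ij≡τ-Mj

up-row-stable : ∀ {n} {w x : Permutation′ n} {i j J m M m′} →
  UpData w x i j J m → UpData w x M j J m′ → □ (ρ w) M i J j ≡ 0ℤ → m ≤ m′
up-row-stable {w = w} {x} {i} {j} {J} {m} {M} {m′} u u′ flat-w-Mi =
  ℕP.≮⇒≥ (λ m′<m → UpData.m-min u m′<m (UpData.X-mJ u′) D-m′J)
  where
  flat-w-m′M : □ (ρ w) m′ M J j ≡ 0ℤ
  flat-w-m′M = trans (sym (□-flip (ρ w) m′ M J j)) (UpData.D-mJ u′)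
  -- the box spanned by p and (m′ , J) is the union of two boxes flat for w
  D-m′J : D w (i , j) (m′ , J) ≡ + 0
  D-m′J = begin
    D w (i , j) (m′ , J)                  ≡⟨ □-flip (ρ w) m′ i J j ⟩
    □ (ρ w) m′ i J j                      ≡⟨ □-rows (ρ w) m′ M i J j ⟩
    □ (ρ w) m′ M J j + □ (ρ w) M i J j    ≡⟨ cong₂ _+_ flat-w-m′M flat-w-Mi ⟩
    0ℤ + 0ℤ                               ∎
    where open ≡-Reasoning

no-up-after-down : ∀ {n} {w x : Permutation′ n} {i j J m K M} →
  UpData w x i j J m → DownData w x m j K M → M ≤ i →
  ¬ (rkσ w x m j <ℤ rkσ w x i j) → ¬ (rkσ w x M j <ℤ rkσ w x m j) →
  ¬ P↑ w x (M , j)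
no-up-after-down {w = w} {x} {i} {j} {J} {m} {M = M} u d M≤i ¬P↑p ¬P↓q =
  ℤP.<-irrefl (sym τ-Mj≡τ-m′j)
  where
  J′ m′ : ℕ
  J′ = jMinus w x (M , j)
  m′ = proj₁ (up w x (M , j))
  u′ : UpData w x M j J′ m′
  u′ = upData w x M j
  open UpData u using (J≤j-1; X-mJ)
  open DownData d using (m≤M)
  τ : ℕ → ℕ → ℤ
  τ = rkσ w x
  J≤j : J ≤ j
  J≤j = ℕP.≤-trans J≤j-1 (ℕP.pred[n]≤n {j})
  τ-Mj≡τ-mj : τ M j ≡ τ m j
  τ-Mj≡τ-mj = ℤP.≤-antisym (down-row-mono d) (ℤP.≮⇒≥ ¬P↓q)
  flat-mi : Flat w x m i J j × (τ i j ≡ τ m j)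
  flat-mi = up-box-flat u ¬P↑p
  flat-mM : Flat w x m M J j
  flat-mM = proj₁ (flat-rows m≤M M≤i J≤j (proj₁ flat-mi))
  flat-Mi : Flat w x M i J j
  flat-Mi = proj₂ (flat-rows m≤M M≤i J≤j (proj₁ flat-mi))
  τ-ij≡τ-Mj : τ i j ≡ τ M j
  τ-ij≡τ-Mj = trans (proj₂ flat-mi) (sym τ-Mj≡τ-mj)
  X-MJ : InX w x (M , J)
  X-MJ = flat-□-corner τ m M J j (flat⇒□τ≡0 flat-mM) X-mJ τ-Mj≡τ-mj
  J′≡J : J′ ≡ J
  J′≡J = up-column-stable u u′ M≤i flat-Mi X-MJ τ-ij≡τ-Mj
  u″ : UpData w x M j J m′
  u″ = subst (λ k → UpData w x M j k m′) J′≡J u′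
  m≤m′ : m ≤ m′
  m≤m′ = up-row-stable u u″ (Flat.w-flat flat-Mi)
  flat-m′M : Flat w x m′ M J j
  flat-m′M = proj₂ (flat-rows m≤m′ (UpData.m≤i u″) J≤j flat-mM)
  τ-Mj≡τ-m′j : τ M j ≡ τ m′ j
  τ-Mj≡τ-m′j = ℤP.i-j≡0⇒i≡j _ _
    (trans (sym (□-left-zero τ m′ M J j (UpData.X-mJ u″) X-MJ)) (flat⇒□τ≡0 flat-m′M))

lemma4p12 : ∀ {n} (w x : Permutation′ n) → x ≤B w →
    (i j : ℕ) → i ≤ n → 1 ≤ j → j < n →
    ¬ InX w x (i , j) →
    (a b : Fin n) → InR w x a b →
    ¬ InX (x ·t[ a , b ]) x (up w x (i , j)) →
    InX (x ·t[ a , b ]) x (i , j) →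
    ¬ P↑ w x (i , j) →
    Q↓ w x (up w x (i , j)) →
    P↓ w x (up w x (i , j))
lemma4p12 {n} w x _ i j i≤n _ j<n _ a b (_ , (x≤t , _) , t≤w) q∉Xt p∈Xt ¬P↑p Q↓q =
  by-cases (ℕP.≤-total i M) Q↓q
  where
  t : Permutation′ n
  t = x ·t[ a , b ]
  m M : ℕ
  m = proj₁ (up w x (i , j))
  M = proj₁ (down w x (m , j))
  up-p : UpData w x i j (jMinus w x (i , j)) m
  up-p = upData w x i j
  dq : DownData w x m j (jPlus w x (m , j)) M
  dq = downData w x m j j<n (ℕP.≤-trans (UpData.m≤i up-p) i≤n)
  by-cases : i ≤ M ⊎ M ≤ i → Q↓ w x (m , j) → P↓ w x (m , j)
  by-cases (inj₁ i≤M) _ =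
    lower-row-drops w x t x≤t t≤w dq (UpData.m≤i up-p) i≤M i≤n (ℕP.<⇒≤ j<n) q∉Xt p∈Xt
  by-cases (inj₂ M≤i) (inj₁ P↓q) = P↓q
  by-cases (inj₂ M≤i) (inj₂ P↑q↓) = decidable-stable (rkσ w x M j ℤP.<? rkσ w x m j)
    (λ ¬P↓q → no-up-after-down up-p dq M≤i ¬P↑p ¬P↓q P↑q↓)
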